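{- Let $G$ be a tree of order $n$ with $\ell$ leaves and let $1\le m\le\ell$. Then $\operatorname{capt}(G,m)\le\lceil\operatorname{diam}(G)/2\rceil+(m-1)\operatorname{diam}(G)$.
   Context: All graphs are reflexive. The game of one cop and $m$ robbers: in round $0$ the cop chooses a starting vertex, then the robbers choose starting vertices (players may share vertices). In each round $i\ge1$ the cop moves to an adjacent vertex or stays, then every robber moves to an adjacent vertex or stays. Whenever the cop occupies the same vertex as some robbers, those robbers are captured and leave the game. For a cop-win graph (trees are cop-win), $\operatorname{capt}(G,m)$ is the smallest $t$ such that the cop has a strategy guaranteeing all $m$ robbers are captured by round $t$ regardless of the robbers' play. -}

module Defs where

open import Data.Nat using (ℕ; zero; suc; _+_; _*_; _∸_; _≤_; _≡ᵇ_; ⌈_/2⌉)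
open import Data.Bool using (Bool; true; false; if_then_else_)
open import Data.Fin using (Fin; _≟_)
open import Data.List using (List; []; _∷_; _++_; [_]; length; map; allFin; filter)
open import Data.Nat.ListAction using (sum)
open import Data.List.Relation.Unary.Unique.Propositional using (Unique)
open import Data.List.Relation.Binary.Pointwise using (Pointwise)
open import Data.Vec using (Vec; toList)
open import Data.Product using (Σ; ∃; _×_)
open import Data.Sum using (_⊎_)
open import Data.Unit using (⊤)
open import Relation.Nullary using (¬_)
open import Relation.Nullary.Decidable using (¬?)
open import Relation.Binary.PropositionalEquality using (_≡_)

-- A finite simple graph on vertex set Fin n, given by a Boolean adjacency
-- matrix (symmetric, no loops).  Reflexivity of the game ("stay") is built
-- into the move relation below.
record Graph (n : ℕ) : Set where
  field
    adj     : Fin n → Fin n → Bool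
    symm    : ∀ u v → adj u v ≡ adj v u
    irrefl  : ∀ v → adj v v ≡ false

open Graph public

module _ {n : ℕ} (G : Graph n) where

  data Walk : Fin n → Fin n → ℕ → Set where
    here : ∀ {u} → Walk u u 0
    step : ∀ {u w v k} → adj G u w ≡ true → Walk w v k → Walk u v (suc k)

  Connected : Set
  Connected = ∀ u v → ∃ λ k → Walk u v k

  Chain : List (Fin n) → Set
  Chain []           = ⊤
  Chain (x ∷ [])     = ⊤
  Chain (x ∷ y ∷ r)  = (adj G x y ≡ true) × Chain (y ∷ r)

  IsCycle : Fin n → List (Fin n) → Set
  IsCycle x ys = (2 ≤ length ys) × Unique (x ∷ ys) × Chain (x ∷ ys ++ [ x ])

  Acyclic : Set
  Acyclic = ∀ x ys → ¬ IsCycle x ys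

  IsTree : Set
  IsTree = Connected × Acyclic

  degree : Fin n → ℕ
  degree v = sum (map (λ u → if adj G v u then 1 else 0) (allFin n))

  numLeaves : ℕ
  numLeaves = sum (map (λ v → if degree v ≡ᵇ 1 then 1 else 0) (allFin n))

  Dist : Fin n → Fin n → ℕ → Set
  Dist u v d = Walk u v d × (∀ k → Walk u v k → d ≤ k)

  IsDiam : ℕ → Set
  IsDiam d = (∃ λ u → ∃ λ v → Dist u v d) × (∀ u v e → Dist u v e → e ≤ d)

  Step : Fin n → Fin n → Set
  Step a b = (a ≡ b) ⊎ (adj G a b ≡ true)

  capture : Fin n → List (Fin n) → List (Fin n)
  capture c rs = filter (λ r → ¬? (r ≟ c)) rs

  -- CopWins k c rs : the cop is at c, the robbers still in the game are at rs,
  -- and it is the cop's turn; the cop can guarantee that all robbers are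
  -- captured within k further rounds.
  CopWins : ℕ → Fin n → List (Fin n) → Set
  CopWins zero    c rs = rs ≡ []
  CopWins (suc k) c rs =
    Σ (Fin n) λ c' → Step c c' ×
      (∀ rs' → Pointwise Step (capture c' rs) rs' → CopWins k c' (capture c' rs'))

  -- capt(G, m) ≤ t : the cop has a strategy guaranteeing that all m robbers
  -- are captured by round t (round 0 = choice of starting positions).
  CaptLe : ℕ → ℕ → Set
  CaptLe m t = Σ (Fin n) λ c → (rs : Vec (Fin n) m) → CopWins t c (capture c (toList rs))

{-# OPTIONS --safe #-}
-- Root the tree at a vertex z.  A robber strictly inside the subtree of the
-- cop's vertex c cannot leave that subtree without stepping onto c, so if the
-- cop always steps to the child of c above the robber she chases, that robber
-- stays below her while her depth grows by one per round; it is caught once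
-- she has descended e − depth c more levels, e bounding all depths.
-- Starting at the midpoint of a diametral path, within ⌈d/2⌉ of every vertex,
-- the first capture takes at most ⌈d/2⌉ rounds; afterwards the cop re-roots the
-- tree at her current vertex, where every depth is at most d, so each further
-- robber costs at most d rounds.
module Submission where

open import Defs
open import Data.Bool using (true)
open import Data.Bool.Properties using () renaming (_≟_ to _≟ᵇ_)
open import Data.Empty using (⊥; ⊥-elim)
open import Data.Fin using (Fin; _≟_)
open import Data.Fin.Properties using (any?)
open import Data.List using (List; []; _∷_; _++_; [_]; length)
open import Data.List.Properties using (length-filter)
open import Data.List.Relation.Binary.Pointwise using (Pointwise; []; _∷_; Pointwise-length)
open import Data.List.Relation.Unary.All as All using (All; []; _∷_)
open import Data.List.Relation.Unary.All.Properties using (all-filter; ∷ʳ⁺)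
open import Data.List.Relation.Unary.AllPairs using ([]; _∷_)
import Data.List.Relation.Unary.AllPairs.Properties as AllPairs
open import Data.List.Relation.Unary.Unique.Propositional using (Unique)
open import Data.Nat using (ℕ; zero; suc; _+_; _*_; _∸_; _≤_; _<_; z≤n; s≤s; ⌈_/2⌉; ⌊_/2⌋)
open import Data.Nat.Properties hiding (_≟_)
open import Algebra.Properties.CommutativeSemigroup +-commutativeSemigroup using (x∙yz≈xz∙y)
open import Data.Product using (Σ; _×_; _,_; proj₁; proj₂)
open import Data.Sum using (_⊎_; inj₁; inj₂)
open import Data.Unit using (⊤; tt)
open import Data.Vec using (toList)
open import Data.Vec.Properties using (length-toList)
open import Function using (_∘_)
open import Relation.Binary.Definitions using (tri<; tri≈; tri>)
open import Relation.Binary.PropositionalEquality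
  using (_≡_; _≢_; refl; sym; trans; cong; subst; ≢-sym)
open import Relation.Nullary using (Dec; yes; no)
open import Relation.Nullary.Decidable using (_×-dec_; ¬?)
import Relation.Unary as U

least-witness : ∀ {p} {P : ℕ → Set p} → U.Decidable P →
                ∀ {k} → P k → Σ ℕ λ m → P m × (∀ j → P j → m ≤ j)
least-witness P? {k} pk with P? 0
... | yes p0 = 0 , p0 , λ _ _ → z≤n
least-witness P? {zero}  pk | no ¬p0 = ⊥-elim (¬p0 pk)
least-witness P? {suc k} pk | no ¬p0 with least-witness (P? ∘ suc) pk
... | m , pm , minimal = suc m , pm , λ where
  zero    p0 → ⊥-elim (¬p0 p0)
  (suc j) pj → s≤s (minimal j pj)

module Walks {n : ℕ} (G : Graph n) where

  walk-0 : ∀ {u v} → Walk G u v 0 → u ≡ v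
  walk-0 here = refl

  infixr 5 _++ʷ_
  _++ʷ_ : ∀ {u w v k l} → Walk G u w k → Walk G w v l → Walk G u v (k + l)
  here     ++ʷ q = q
  step a p ++ʷ q = step a (p ++ʷ q)

  walk-reverse : ∀ {u v k} → Walk G u v k → Walk G v u k
  walk-reverse here = here
  walk-reverse {u} {k = suc k} (step {w = w} u~w p) =
    subst (Walk G _ u) (+-comm k 1) (walk-reverse p ++ʷ step (trans (symm G w u) u~w) here)

  walk? : ∀ k u v → Dec (Walk G u v k)
  walk? zero u v with u ≟ v
  ... | yes refl = yes here
  ... | no u≢v   = no (u≢v ∘ walk-0)
  walk? (suc k) u v with any? (λ w → (adj G u w ≟ᵇ true) ×-dec walk? k w v)
  ... | yes (w , u~w , p) = yes (step u~w p)
  ... | no ∄w             = no λ { (step {w = w} u~w p) → ∄w (w , u~w , p) }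

module Distance {n : ℕ} (G : Graph n) (connected : Connected G) where
  open Walks G

  shortest : ∀ u v → Σ ℕ (Dist G u v)
  shortest u v = least-witness (λ k → walk? k u v) (proj₂ (connected u v))

  dist : Fin n → Fin n → ℕ
  dist u v = proj₁ (shortest u v)

  dist-walk : ∀ u v → Walk G u v (dist u v)
  dist-walk u v = proj₁ (proj₂ (shortest u v))

  dist-min : ∀ {u v k} → Walk G u v k → dist u v ≤ k
  dist-min {u} {v} = proj₂ (proj₂ (shortest u v)) _

module RootedTree {n : ℕ} (G : Graph n) (tree : IsTree G) (z : Fin n) where
  open Walks G
  open Distance G (proj₁ tree)

  depth : Fin n → ℕ
  depth v = dist v z

  depth≡0⇒root : ∀ {v} → depth v ≡ 0 → v ≡ z
  depth≡0⇒root {v} eq = walk-0 (subst (Walk G v z) eq (dist-walk v z))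

  depth-root : depth z ≡ 0
  depth-root = n≤0⇒n≡0 (dist-min {z} here)

  depth-adj : ∀ {u w} → adj G u w ≡ true → depth u ≤ suc (depth w)
  depth-adj u~w = dist-min (step u~w (dist-walk _ z))

  parent : ∀ {v e} → depth v ≡ suc e → Σ (Fin n) λ p → adj G v p ≡ true × depth p ≡ e
  parent {v} eq with subst (Walk G v z) eq (dist-walk v z)
  ... | step {w = p} v~p p→z =
    p , v~p , ≤-antisym (dist-min p→z) (≤-pred (subst (_≤ suc (depth p)) eq (depth-adj v~p)))

  shallower⇒≢ : ∀ {u v} → depth u < depth v → u ≢ v
  shallower⇒≢ lt refl = <-irrefl refl lt

  shallower-∉ : ∀ {p e} → depth p ≡ e → ∀ {vs} → All (λ v → suc e ≤ depth v) vs → All (_≢ p) vs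
  shallower-∉ refl = All.map (≢-sym ∘ shallower⇒≢)

  Path : Fin n → List (Fin n) → Fin n → Set
  Path a []       b = a ≡ b
  Path a (v ∷ vs) b = adj G a v ≡ true × Path v vs b

  path-chain : ∀ {a b} vs → Path a vs b → Chain G (a ∷ vs)
  path-chain []       _         = tt
  path-chain (v ∷ vs) (a~v , p) = a~v , path-chain vs p

  path-snoc : ∀ {a b c} vs → Path a vs b → adj G b c ≡ true → Path a (vs ++ [ c ]) c
  path-snoc []       refl      b~c = b~c , refl
  path-snoc (v ∷ vs) (a~v , p) b~c = a~v , path-snoc vs p b~c

  -- Both ends climb to their parents: equal parents close a cycle, distinct
  -- ones extend the path one level up; at the root the two ends would coincide.
  ¬same-depth-path : ∀ e {x y} vs → depth x ≡ e → depth y ≡ e → x ≢ y → Path y vs x →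
                     Unique (y ∷ vs) → All (λ v → e ≤ depth v) (y ∷ vs) → ⊥
  ¬same-depth-path zero _ dx dy x≢y _ _ _ =
    x≢y (trans (depth≡0⇒root dx) (sym (depth≡0⇒root dy)))
  ¬same-depth-path (suc e) {x} {y} vs dx dy x≢y y→x unique deep
    with parent dx | parent dy
  ... | px , x~px , dpx | py , y~py , dpy with px ≟ py
  ... | yes refl =
    proj₂ tree px (y ∷ vs)
      (nontrivial vs y→x , All.map ≢-sym px∉ ∷ unique ,
       trans (symm G px y) y~py , path-chain (vs ++ [ px ]) (path-snoc vs y→x x~px))
    where
      px∉ : All (_≢ px) (y ∷ vs)
      px∉ = shallower-∉ dpx deep
      nontrivial : ∀ vs → Path y vs x → 2 ≤ length (y ∷ vs)
      nontrivial []      y≡x = ⊥-elim (x≢y (sym y≡x))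
      nontrivial (_ ∷ _) _   = s≤s (s≤s z≤n)
  ... | no px≢py =
    ¬same-depth-path e (y ∷ vs ++ [ px ]) dpx dpy px≢py
      (trans (symm G py y) y~py , path-snoc vs y→x x~px)
      (∷ʳ⁺ (All.map ≢-sym (shallower-∉ dpy deep)) (≢-sym px≢py) ∷
         AllPairs.++⁺ unique ([] ∷ []) (All.map (_∷ []) (shallower-∉ dpx deep)))
      (≤-reflexive (sym dpy) ∷ ∷ʳ⁺ (All.map <⇒≤ deep) (≤-reflexive (sym dpx)))

  adj⇒≢ : ∀ {u w} → adj G u w ≡ true → u ≢ w
  adj⇒≢ {u} u~u refl with trans (sym u~u) (irrefl G u)
  ... | ()

  adjacent-depths : ∀ {u w} → adj G u w ≡ true →
                    depth w ≡ suc (depth u) ⊎ depth u ≡ suc (depth w)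
  adjacent-depths {u} {w} u~w with <-cmp (depth u) (depth w)
  ... | tri< lt _ _ = inj₁ (≤-antisym (depth-adj (trans (symm G w u) u~w)) lt)
  ... | tri> _ _ gt = inj₂ (≤-antisym (depth-adj u~w) gt)
  ... | tri≈ _ eq _ =
    ⊥-elim (¬same-depth-path (depth w) (w ∷ []) refl eq (≢-sym (adj⇒≢ u~w)) (u~w , refl)
              ((adj⇒≢ u~w ∷ []) ∷ [] ∷ []) (≤-reflexive (sym eq) ∷ ≤-refl ∷ []))

  unique-parent : ∀ {w u u' e} → adj G w u ≡ true → adj G w u' ≡ true →
                  depth u ≡ e → depth u' ≡ e → depth w ≡ suc e → u ≡ u'
  unique-parent {w} {u} {u'} {e} w~u w~u' du du' dw with u ≟ u'
  ... | yes u≡u' = u≡u'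
  ... | no u≢u' =
    ⊥-elim (¬same-depth-path e (w ∷ u ∷ []) du du' u≢u' (trans (symm G u' w) w~u' , w~u , refl)
              distinct (≤-reflexive (sym du') ∷ <⇒≤ e<w ∷ ≤-reflexive (sym du) ∷ []))
    where
      e<w : e < depth w
      e<w = ≤-reflexive (sym dw)
      ≢w : ∀ v → depth v ≡ e → v ≢ w
      ≢w v dv = shallower⇒≢ (subst (_< depth w) (sym dv) e<w)
      distinct : Unique (u' ∷ w ∷ u ∷ [])
      distinct = (≢w u' du' ∷ ≢-sym u≢u' ∷ []) ∷ (≢-sym (≢w u du) ∷ []) ∷ [] ∷ []

  infix 4 _≼_
  data _≼_ (c : Fin n) : Fin n → Set where
    ≼-refl  : c ≼ c
    ≼-child : ∀ {p r} → adj G r p ≡ true → depth r ≡ suc (depth p) → c ≼ p → c ≼ r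

  ≼-depth : ∀ {c r} → c ≼ r → depth c ≤ depth r
  ≼-depth ≼-refl              = ≤-refl
  ≼-depth (≼-child _ dr c≼p) = ≤-trans (≼-depth c≼p) (subst (_ ≤_) (sym dr) (n≤1+n _))

  ≼-walk : ∀ {c r} → c ≼ r → Σ ℕ λ k → Walk G r c k × k + depth c ≡ depth r
  ≼-walk ≼-refl = 0 , here , refl
  ≼-walk (≼-child r~p dr c≼p) with ≼-walk c≼p
  ... | k , p→c , eq = suc k , step r~p p→c , trans (cong suc eq) (sym dr)

  ancestor : ∀ j v → j ≤ depth v → Σ (Fin n) λ c → c ≼ v × depth c + j ≡ depth v
  ancestor zero v _ = v , ≼-refl , +-identityʳ _
  ancestor (suc j) v j<dv with depth v in dv
  ... | suc e with parent dv
  ...   | p , v~p , dp with ancestor j p (subst (j ≤_) (sym dp) (≤-pred j<dv))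
  ...     | c , c≼p , eq = c , ≼-child v~p (trans dv (cong suc (sym dp))) c≼p ,
                           trans (+-suc (depth c) j) (cong suc (trans eq dp))

  root-≼ : ∀ v → z ≼ v
  root-≼ v with ancestor (depth v) v ≤-refl
  ... | c , c≼v , eq = subst (_≼ v) (depth≡0⇒root (+-cancelʳ-≡ (depth v) (depth c) 0 eq)) c≼v

  step-toward : ∀ {c r} → c ≼ r → r ≢ c →
                Σ (Fin n) λ c' → adj G c c' ≡ true × depth c' ≡ suc (depth c) × c' ≼ r
  step-toward ≼-refl r≢c = ⊥-elim (r≢c refl)
  step-toward {c} (≼-child {p} {r} r~p dr c≼p) _ with p ≟ c
  ... | yes refl = r , trans (symm G p r) r~p , dr , ≼-refl
  ... | no p≢c with step-toward c≼p p≢c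
  ...   | c' , c~c' , dc' , c'≼p = c' , c~c' , dc' , ≼-child r~p dr c'≼p

  ≼-deeper : ∀ {c r} → c ≼ r → r ≢ c → depth c < depth r
  ≼-deeper c≼r r≢c with step-toward c≼r r≢c
  ... | _ , _ , dc' , c'≼r = subst (_≤ _) dc' (≼-depth c'≼r)

  ≼-step : ∀ {c r r'} → c ≼ r → r ≢ c → Step G r r' → c ≼ r'
  ≼-step c≼r _ (inj₁ refl) = c≼r
  ≼-step {r = r} {r'} c≼r r≢c (inj₂ r~r') with adjacent-depths r~r'
  ... | inj₁ down = ≼-child (trans (symm G r' r) r~r') down c≼r
  ≼-step ≼-refl r≢c (inj₂ _) | inj₂ _ = ⊥-elim (r≢c refl)
  ≼-step (≼-child r~p dr c≼p) _ (inj₂ r~r') | inj₂ up =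
    subst (_ ≼_) (unique-parent r~p r~r' refl (suc-injective (trans (sym up) dr)) dr) c≼p

  walk-through : ∀ {c r v k} → c ≼ r → Walk G r v k →
                 c ≼ v ⊎ Σ ℕ λ k₁ → Σ ℕ λ k₂ → k₁ + k₂ ≡ k × Walk G r c k₁ × Walk G c v k₂
  walk-through c≼r here = inj₁ c≼r
  walk-through {c} {r} c≼r (step r~w w→v) with r ≟ c
  ... | yes refl = inj₂ (0 , _ , refl , here , step r~w w→v)
  ... | no r≢c with walk-through (≼-step c≼r r≢c (inj₂ r~w)) w→v
  ...   | inj₁ c≼v = inj₁ c≼v
  ...   | inj₂ (k₁ , k₂ , eq , w→c , c→v) = inj₂ (suc k₁ , k₂ , cong suc eq , step r~w w→c , c→v)

module Pursuit {n : ℕ} (G : Graph n) (tree : IsTree G) (d : ℕ) (diam : IsDiam G d) where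
  open Walks G
  open Distance G (proj₁ tree)
  module T = RootedTree G tree
  open ≤-Reasoning

  dist≤diam : ∀ u v → dist u v ≤ d
  dist≤diam u v = proj₂ diam u v (dist u v) (dist-walk u v , λ _ → dist-min)

  -- The midpoint of a diametral path a — b: its subtree (rooted at a) has
  -- height ≤ ⌊d/2⌋, and a walk leaving the subtree passes through it.
  center : ∀ {a b} → Dist G a b d → Σ (Fin n) λ z → ∀ v → dist v z ≤ ⌈ d /2⌉
  center {a} {b} (a→b , a→b-min) = z , radius
    where
      open T a using (depth; _≼_; ancestor; ≼-walk; walk-through)

      depth-b : depth b ≡ d
      depth-b = ≤-antisym (dist-min (walk-reverse a→b)) (a→b-min _ (walk-reverse (dist-walk b a)))

      midpoint : Σ (Fin n) λ c → c ≼ b × depth c + ⌊ d /2⌋ ≡ depth b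
      midpoint = ancestor ⌊ d /2⌋ b (subst (⌊ d /2⌋ ≤_) (sym depth-b) (⌊n/2⌋≤n d))

      z : Fin n
      z = proj₁ midpoint

      depth-z : depth z ≡ ⌈ d /2⌉
      depth-z = +-cancelˡ-≡ ⌊ d /2⌋ _ _ (begin-equality
        ⌊ d /2⌋ + depth z  ≡⟨ +-comm ⌊ d /2⌋ (depth z) ⟩
        depth z + ⌊ d /2⌋  ≡⟨ trans (proj₂ (proj₂ midpoint)) depth-b ⟩
        d                  ≡⟨ ⌊n/2⌋+⌈n/2⌉≡n d ⟨
        ⌊ d /2⌋ + ⌈ d /2⌉  ∎)

      inside : ∀ {v} → z ≼ v → dist v z ≤ ⌈ d /2⌉
      inside {v} z≼v with ≼-walk z≼v
      ... | k , v→z , eq = begin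
        dist v z  ≤⟨ dist-min v→z ⟩
        k         ≤⟨ +-cancelʳ-≤ ⌈ d /2⌉ k ⌊ d /2⌋ k+⌈d/2⌉≤⌊d/2⌋+⌈d/2⌉ ⟩
        ⌊ d /2⌋   ≤⟨ ⌊n/2⌋≤⌈n/2⌉ d ⟩
        ⌈ d /2⌉   ∎
        where
          k+⌈d/2⌉≤⌊d/2⌋+⌈d/2⌉ : k + ⌈ d /2⌉ ≤ ⌊ d /2⌋ + ⌈ d /2⌉
          k+⌈d/2⌉≤⌊d/2⌋+⌈d/2⌉ = begin
            k + ⌈ d /2⌉        ≡⟨ cong (k +_) depth-z ⟨
            k + depth z        ≡⟨ eq ⟩
            depth v            ≤⟨ dist≤diam v a ⟩
            d                  ≡⟨ ⌊n/2⌋+⌈n/2⌉≡n d ⟨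
            ⌊ d /2⌋ + ⌈ d /2⌉  ∎

      through : ∀ {v k₁ k₂} → k₁ + k₂ ≡ dist b v → Walk G b z k₁ → Walk G z v k₂ →
                dist v z ≤ ⌈ d /2⌉
      through {v} {k₁} {k₂} eq b→z z→v = begin
        dist v z  ≤⟨ dist-min (walk-reverse z→v) ⟩
        k₂        ≤⟨ +-cancelˡ-≤ k₁ k₂ (depth z) k₁+k₂≤k₁+depth-z ⟩
        depth z   ≡⟨ depth-z ⟩
        ⌈ d /2⌉   ∎
        where
          k₁+k₂≤k₁+depth-z : k₁ + k₂ ≤ k₁ + depth z
          k₁+k₂≤k₁+depth-z = begin
            k₁ + k₂       ≡⟨ eq ⟩
            dist b v      ≤⟨ dist≤diam b v ⟩
            d             ≡⟨ depth-b ⟨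
            depth b       ≤⟨ dist-min (b→z ++ʷ dist-walk z a) ⟩
            k₁ + depth z  ∎

      radius : ∀ v → dist v z ≤ ⌈ d /2⌉
      radius v with walk-through (proj₁ (proj₂ midpoint)) (dist-walk b v)
      ... | inj₁ z≼v                        = inside z≼v
      ... | inj₂ (_ , _ , eq , b→z , z→v)  = through eq b→z z→v

  copWins-[] : ∀ k c → CopWins G k c []
  copWins-[] zero    c = refl
  copWins-[] (suc k) c = c , inj₁ refl , λ { [] [] → copWins-[] k c }

  capture-≢ : ∀ c rs → All (_≢ c) (capture G c rs)
  capture-≢ c = all-filter (λ r → ¬? (r ≟ c))

  length-capture : ∀ c rs → length (capture G c rs) ≤ length rs
  length-capture c = length-filter (λ r → ¬? (r ≟ c))

  length-survivors : ∀ c rs {rs'} → Pointwise (Step G) (capture G c rs) rs' →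
                     length (capture G c rs') ≤ length rs
  length-survivors c rs {rs'} moved = begin
    length (capture G c rs')  ≤⟨ length-capture c rs' ⟩
    length rs'                ≡⟨ Pointwise-length moved ⟨
    length (capture G c rs)   ≤⟨ length-capture c rs ⟩
    length rs                 ∎

  -- The cop at c chases the first robber r inside the tree rooted at z, of
  -- height at most e; r still needs e − depth c rounds, each other robber d.
  Chase : ℕ → Fin n → List (Fin n) → Set
  Chase k c []         = ⊤
  Chase k c (r ∷ rest) = Σ (Fin n) λ z → Σ ℕ λ e →
    (∀ v → dist v z ≤ e) × T._≼_ z c r × e + length rest * d ≤ k + dist c z

  chase-from : ∀ {k c e} → (∀ v → dist v c ≤ e) → ∀ rs → e + length rs * d ≤ k + d → Chase k c rs
  chase-from ecc []         _      = tt
  chase-from {k} {c} {e} ecc (r ∷ rest) budget = c , e , ecc , T.root-≼ c r , (begin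
    e + length rest * d  ≤⟨ +-cancelʳ-≤ d _ _ (subst (_≤ k + d) (x∙yz≈xz∙y e d _) budget) ⟩
    k                    ≡⟨ +-identityʳ k ⟨
    k + 0                ≡⟨ cong (k +_) (T.depth-root c) ⟨
    k + dist c c         ∎)

  chase-start : ∀ {z} m → (∀ v → dist v z ≤ ⌈ d /2⌉) →
                ∀ rs → length rs ≤ suc m → Chase (⌈ d /2⌉ + m * d) z rs
  chase-start m ecc rs fits = chase-from ecc rs (begin
    ⌈ d /2⌉ + length rs * d  ≤⟨ +-monoʳ-≤ ⌈ d /2⌉ (*-monoˡ-≤ d fits) ⟩
    ⌈ d /2⌉ + (d + m * d)    ≡⟨ x∙yz≈xz∙y ⌈ d /2⌉ d (m * d) ⟩
    ⌈ d /2⌉ + m * d + d      ∎)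

  pursue : ∀ k c rs → All (_≢ c) rs → Chase k c rs → CopWins G k c rs
  pursue k c [] _ _ = copWins-[] k c
  pursue zero c (r ∷ rest) (r≢c ∷ _) (z , e , ecc , c≼r , budget) =
    ⊥-elim (<-irrefl refl (begin-strict
      dist c z                 <⟨ T.≼-deeper z c≼r r≢c ⟩
      dist r z                 ≤⟨ ecc r ⟩
      e                        ≤⟨ m≤m+n e _ ⟩
      e + length rest * d      ≤⟨ budget ⟩
      dist c z                 ∎))
  pursue (suc k) c (r ∷ rest) (r≢c ∷ _) (z , e , ecc , c≼r , budget)
    with T.step-toward z c≼r r≢c
  ... | c' , c~c' , dc' , c'≼r =
    c' , inj₂ c~c' , λ rs' moved →
      pursue k c' (capture G c' rs') (capture-≢ c' rs') (chase-next rs' moved)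
    where
      rest-in-time : length rest * d ≤ k
      rest-in-time = +-cancelˡ-≤ (suc (dist c z)) _ _ (begin
        suc (dist c z) + length rest * d  ≤⟨ +-monoˡ-≤ _ (≤-trans (T.≼-deeper z c≼r r≢c) (ecc r)) ⟩
        e + length rest * d               ≤⟨ budget ⟩
        suc k + dist c z                  ≡⟨ cong suc (+-comm k (dist c z)) ⟩
        suc (dist c z) + k                ∎)

      restart : ∀ rs → length rs ≤ length rest → Chase k c' rs
      restart rs shorter = chase-from (λ v → dist≤diam v c') rs (begin
        d + length rs * d  ≡⟨ +-comm d _ ⟩
        length rs * d + d  ≤⟨ +-monoˡ-≤ d (≤-trans (*-monoˡ-≤ d shorter) rest-in-time) ⟩
        k + d              ∎)

      chase-next : ∀ rs' → Pointwise (Step G) (capture G c' (r ∷ rest)) rs' →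
                   Chase k c' (capture G c' rs')
      chase-next rs' moved with r ≟ c'
      ... | yes _ = restart _ (length-survivors c' rest moved)
      ... | no r≢c' with moved
      ...   | _∷_ {y = r'} {ys = rest'} r→r' moved' with r' ≟ c'
      ...     | yes _ = restart _ (length-survivors c' rest moved')
      ...     | no _  = z , e , ecc , T.≼-step z c'≼r r≢c' r→r' , (begin
        e + length (capture G c' rest') * d  ≤⟨ +-monoʳ-≤ e (*-monoˡ-≤ d (length-survivors c' rest moved')) ⟩
        e + length rest * d                  ≤⟨ budget ⟩
        suc k + dist c z                     ≡⟨ +-suc k _ ⟨
        k + suc (dist c z)                   ≡⟨ cong (k +_) dc' ⟨
        k + dist c' z                        ∎)

theorem3p10 : (n : ℕ) (G : Graph n) → IsTree G →
    (m : ℕ) → 1 ≤ m → m ≤ numLeaves G →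
    (d : ℕ) → IsDiam G d →
    CaptLe G m (⌈ d /2⌉ + (m ∸ 1) * d)
theorem3p10 n G tree m _ _ d diam = z , λ rs →
    pursue _ z (capture G z (toList rs)) (capture-≢ z (toList rs))
      (chase-start (m ∸ 1) radius _ (begin
        length (capture G z (toList rs))  ≤⟨ length-capture z (toList rs) ⟩
        length (toList rs)                ≡⟨ length-toList rs ⟩
        m                                 ≤⟨ m≤n+m∸n m 1 ⟩
        suc (m ∸ 1)                       ∎))
  where
    open Pursuit G tree d diam
    open Distance G (proj₁ tree) using (dist)
    open ≤-Reasoning

    centre : Σ (Fin n) λ z → ∀ v → dist v z ≤ ⌈ d /2⌉
    centre = center (proj₂ (proj₂ (proj₁ diam)))

    z : Fin n
    z = proj₁ centre

    radius : ∀ v → dist v z ≤ ⌈ d /2⌉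
    radius = proj₂ centre
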